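{- (a) For all $n\ge 0$, $U(r^{n+4})=U(r^{n+3})+(r^4+r^3+r^2+r)\,U(r^n)$. (b) For every $n\ge 0$ there is $A_n\in\mathbb{Z}/2[t]$ with $U\big((r^2+r)r^{2n}\big)=(r^2+r)A_n(r^2)$.
   Context: $\mathbb{Z}/2[r]$, $\mathbb{Z}/2[t]$ are polynomial rings over the field with two elements; $F=r(r+1)^3$, $G=r^3(r+1)$. $\mathbb{Z}/2[r]$ is a free $\mathbb{Z}/2[G]$-module with basis $1,r,r^2,r^3$. $U:\mathbb{Z}/2[r]\to\mathbb{Z}/2[r]$ is $U\big(\sum_{i=0}^3 g_i(G)r^i\big)=\sum_{i=0}^3 g_i(F)U(r^i)$ with $U(1)=1$, $U(r)=r$, $U(r^2)=r^2$, $U(r^3)=r^3+r^2+r$. -}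

module Defs where

open import Data.Bool using (Bool; true; false; _xor_; if_then_else_)
open import Data.List using (List; []; _∷_; length; replicate; _++_)
open import Data.Nat using (ℕ; zero; suc)
open import Data.Product using (_×_; _,_)
open import Data.Vec using (Vec; []; _∷_)
open import Relation.Binary.PropositionalEquality using (_≡_)

-- Polynomials over ℤ/2 (Bool with xor as addition, ∧ as multiplication),
-- as coefficient lists, lowest degree first. Used both for ℤ/2[r] and ℤ/2[t].
Poly : Set
Poly = List Bool

coeff : Poly → ℕ → Bool
coeff []      _       = false
coeff (a ∷ p) zero    = a
coeff (a ∷ p) (suc k) = coeff p k

-- equality of polynomials: all coefficients agree (ignores trailing zeros)
infix 4 _≈_
_≈_ : Poly → Poly → Set
p ≈ q = ∀ k → coeff p k ≡ coeff q k

infixl 6 _⊕_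
_⊕_ : Poly → Poly → Poly
[]      ⊕ q       = q
(a ∷ p) ⊕ []      = a ∷ p
(a ∷ p) ⊕ (b ∷ q) = (a xor b) ∷ (p ⊕ q)

scale : Bool → Poly → Poly
scale a p = if a then p else []

infixl 7 _⊗_
_⊗_ : Poly → Poly → Poly
[]      ⊗ q = []
(a ∷ p) ⊗ q = scale a q ⊕ (false ∷ (p ⊗ q))

comp : Poly → Poly → Poly
comp []      h = []
comp (a ∷ g) h = (a ∷ []) ⊕ (h ⊗ comp g h)

X^ : ℕ → Poly
X^ n = replicate n false ++ (true ∷ [])

-- F = r(r+1)^3 = r + r^2 + r^3 + r^4 ,  G = r^3(r+1) = r^3 + r^4
F G : Poly
F = false ∷ true ∷ true ∷ true ∷ true ∷ []
G = false ∷ false ∷ false ∷ true ∷ true ∷ []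

-- Division with remainder by the monic polynomial G:
-- divG f = (q , s) with f = q·G + s, s = s0 + s1 r + s2 r^2 + s3 r^3.
divG : Poly → Poly × Vec Bool 4
divG [] = [] , (false ∷ false ∷ false ∷ false ∷ [])
divG (a ∷ p) with divG p
... | q , (s0 ∷ s1 ∷ s2 ∷ false ∷ []) = (false ∷ q) , (a ∷ s0 ∷ s1 ∷ s2 ∷ [])
... | q , (s0 ∷ s1 ∷ s2 ∷ true  ∷ []) = (true  ∷ q) , (a ∷ s0 ∷ s1 ∷ (s2 xor true) ∷ [])

-- Coordinates of f in the basis 1, r, r^2, r^3 of ℤ/2[r] over ℤ/2[G]:
-- coords n f = (g0 , g1 , g2 , g3) with f = Σ g_i(G) r^i, computed by
-- repeated division by G (n = fuel; n = length f suffices).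
coords : ℕ → Poly → Vec Poly 4
coords zero    f = [] ∷ [] ∷ [] ∷ [] ∷ []
coords (suc n) f with divG f
... | q , (s0 ∷ s1 ∷ s2 ∷ s3 ∷ []) with coords n q
...   | g0 ∷ g1 ∷ g2 ∷ g3 ∷ [] = (s0 ∷ g0) ∷ (s1 ∷ g1) ∷ (s2 ∷ g2) ∷ (s3 ∷ g3) ∷ []

Ubasis : Vec Poly 4
Ubasis = (true ∷ [])
       ∷ (false ∷ true ∷ [])
       ∷ (false ∷ false ∷ true ∷ [])
       ∷ (false ∷ true ∷ true ∷ true ∷ [])
       ∷ []

-- U(Σ g_i(G) r^i) = Σ g_i(F) U(r^i)
U : Poly → Poly
U f with coords (length f) f | Ubasis
... | g0 ∷ g1 ∷ g2 ∷ g3 ∷ [] | u0 ∷ u1 ∷ u2 ∷ u3 ∷ [] =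
  comp g0 F ⊗ u0 ⊕ comp g1 F ⊗ u1 ⊕ comp g2 F ⊗ u2 ⊕ comp g3 F ⊗ u3

{-# OPTIONS --safe #-}
module Submission where

-- U is additive, respects _≈_, and satisfies U(f + g G) = U(f) + F U(g): writing
-- f = q G + s with deg s < 4 gives U(f) = U(s) + F U(q), and one division by G is
-- computed from the previous one by a shift.  Since r⁴ = r³ + G, part (a) is just
-- U(r^(n+4)) = U(r^(n+3) + r^n G).  For (b), r⁸ = r⁶ + G², so B_n = U((r²+r) r^(2n))
-- satisfies B_(n+4) = B_(n+3) + F² B_n; as F² = F(r²) in characteristic 2, the
-- polynomials A_(n+4) = A_(n+3) + F A_n, with A_0, …, A_3 found by computation,
-- give B_n = (r²+r) A_n(r²).

open import Defs
open import Algebra.Bundles using (CommutativeMonoid; CommutativeRing)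
open import Data.Bool using (Bool; true; false; _xor_)
open import Data.Bool.Properties
  using (xor-assoc; xor-comm; xor-identityʳ; xor-same; xor-∧-commutativeRing)
  renaming (_≟_ to _≟ᵇ_)
open import Data.List using ([]; _∷_; length)
open import Data.List.Relation.Unary.All as All using (All; all?)
open import Data.Maybe using (nothing)
open import Data.Nat using (ℕ; zero; suc; _+_; _*_; _≤_; z≤n; s≤s)
open import Data.Nat.Properties using (≤-trans; m≤m+n; m≤n+m; n≤1+n; +-comm; *-distribˡ-+)
open import Data.Product using (_×_; Σ; _,_; proj₁; proj₂)
open import Data.Vec using (Vec; []; _∷_; map; zipWith; replicate)
open import Data.Vec.Properties using (zipWith-identityˡ; zipWith-identityʳ)
open import Function using (id)
open import Relation.Binary.Bundles using (Setoid)
open import Relation.Binary.PropositionalEquality using (_≡_; refl; sym; trans; cong; cong₂)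
open import Relation.Nullary.Decidable using (True; toWitness)
open import Tactic.RingSolver using (solve-∀)
open import Tactic.RingSolver.Core.AlmostCommutativeRing
  using (AlmostCommutativeRing; fromCommutativeRing)

infix 4 _≋_

-- _≈_ wrapped in a record, so that both polynomials can be inferred from a proof.
record _≋_ (p q : Poly) : Set where
  constructor mk≋
  field coeffs : p ≈ q
open _≋_

≋-refl : ∀ {p} → p ≋ p
≋-refl = mk≋ λ _ → refl

≋-sym : ∀ {p q} → p ≋ q → q ≋ p
≋-sym (mk≋ e) = mk≋ λ k → sym (e k)

≋-trans : ∀ {p q r} → p ≋ q → q ≋ r → p ≋ r
≋-trans (mk≋ e) (mk≋ f) = mk≋ λ k → trans (e k) (f k)

≡⇒≋ : ∀ {p q} → p ≡ q → p ≋ q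
≡⇒≋ refl = ≋-refl

≋-setoid : Setoid _ _
≋-setoid = record
  { Carrier = Poly ; _≈_ = _≋_
  ; isEquivalence = record { refl = ≋-refl ; sym = ≋-sym ; trans = ≋-trans } }

∷-cong : ∀ {a b p q} → a ≡ b → p ≋ q → a ∷ p ≋ b ∷ q
∷-cong a≡b (mk≋ e) = mk≋ λ { zero → a≡b ; (suc k) → e k }

∷-injective : ∀ {a b p q} → a ∷ p ≋ b ∷ q → a ≡ b × p ≋ q
∷-injective (mk≋ e) = e zero , mk≋ λ k → e (suc k)

∷-≋-[] : ∀ {a p} → a ∷ p ≋ [] → a ≡ false × p ≋ []
∷-≋-[] (mk≋ e) = e zero , mk≋ λ k → e (suc k)

false∷-≋-[] : ∀ {p} → p ≋ [] → false ∷ p ≋ []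
false∷-≋-[] (mk≋ e) = mk≋ λ { zero → refl ; (suc k) → e k }

coeff-⊕ : ∀ p q k → coeff (p ⊕ q) k ≡ coeff p k xor coeff q k
coeff-⊕ []      q       k       = refl
coeff-⊕ (a ∷ p) []      zero    = sym (xor-identityʳ a)
coeff-⊕ (a ∷ p) []      (suc k) = sym (xor-identityʳ _)
coeff-⊕ (a ∷ p) (b ∷ q) zero    = refl
coeff-⊕ (a ∷ p) (b ∷ q) (suc k) = coeff-⊕ p q k

⊕-cong : ∀ {p p′ q q′} → p ≋ p′ → q ≋ q′ → p ⊕ q ≋ p′ ⊕ q′
⊕-cong {p} {p′} {q} {q′} (mk≋ e) (mk≋ f) = mk≋ λ k →
  trans (coeff-⊕ p q k) (trans (cong₂ _xor_ (e k) (f k)) (sym (coeff-⊕ p′ q′ k)))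

⊕-congˡ : ∀ p {q q′} → q ≋ q′ → p ⊕ q ≋ p ⊕ q′
⊕-congˡ p = ⊕-cong ≋-refl

⊕-congʳ : ∀ q {p p′} → p ≋ p′ → p ⊕ q ≋ p′ ⊕ q
⊕-congʳ q e = ⊕-cong e ≋-refl

⊕-assoc : ∀ p q r → (p ⊕ q) ⊕ r ≋ p ⊕ (q ⊕ r)
⊕-assoc p q r = mk≋ λ k →
  trans (coeff-⊕ (p ⊕ q) r k) (trans (cong (_xor coeff r k) (coeff-⊕ p q k))
  (trans (xor-assoc (coeff p k) _ _)
  (trans (cong (coeff p k xor_) (sym (coeff-⊕ q r k))) (sym (coeff-⊕ p (q ⊕ r) k)))))

⊕-comm : ∀ p q → p ⊕ q ≋ q ⊕ p
⊕-comm p q = mk≋ λ k →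
  trans (coeff-⊕ p q k) (trans (xor-comm (coeff p k) _) (sym (coeff-⊕ q p k)))

⊕-identityʳ : ∀ p → p ⊕ [] ≋ p
⊕-identityʳ p = mk≋ λ k → trans (coeff-⊕ p [] k) (xor-identityʳ (coeff p k))

⊕-self : ∀ p → p ⊕ p ≋ []
⊕-self p = mk≋ λ k → trans (coeff-⊕ p p k) (xor-same (coeff p k))

[_] : Bool → Poly
[ a ] = a ∷ []

⊕-[false] : ∀ p → p ⊕ [ false ] ≋ p
⊕-[false] p = ≋-trans (⊕-congˡ p (false∷-≋-[] ≋-refl)) (⊕-identityʳ p)

⊕-commutativeMonoid : CommutativeMonoid _ _
⊕-commutativeMonoid = record
  { Carrier = Poly ; _≈_ = _≋_ ; _∙_ = _⊕_ ; ε = []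
  ; isCommutativeMonoid = record
    { isMonoid = record
      { isSemigroup = record
        { isMagma = record { isEquivalence = Setoid.isEquivalence ≋-setoid ; ∙-cong = ⊕-cong }
        ; assoc = ⊕-assoc }
      ; identity = (λ _ → ≋-refl) , ⊕-identityʳ }
    ; comm = ⊕-comm } }

open import Algebra.Properties.CommutativeSemigroup
  (CommutativeMonoid.commutativeSemigroup ⊕-commutativeMonoid)
  using (interchange; x∙yz≈y∙xz)

scale-cong : ∀ a {p q} → p ≋ q → scale a p ≋ scale a q
scale-cong true  e = e
scale-cong false e = ≋-refl

scale-xor : ∀ a b p → scale (a xor b) p ≋ scale a p ⊕ scale b p
scale-xor true  true  p = ≋-sym (⊕-self p)
scale-xor true  false p = ≋-sym (⊕-identityʳ p)
scale-xor false b     p = ≋-refl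

scale-⊗ : ∀ a p q → scale a p ⊗ q ≡ scale a (p ⊗ q)
scale-⊗ true  p q = refl
scale-⊗ false p q = refl

⊗-congˡ : ∀ p {q q′} → q ≋ q′ → p ⊗ q ≋ p ⊗ q′
⊗-congˡ []      e = ≋-refl
⊗-congˡ (a ∷ p) e = ⊕-cong (scale-cong a e) (∷-cong refl (⊗-congˡ p e))

⊗-zeroʳ : ∀ p → p ⊗ [] ≋ []
⊗-zeroʳ []          = ≋-refl
⊗-zeroʳ (false ∷ p) = false∷-≋-[] (⊗-zeroʳ p)
⊗-zeroʳ (true ∷ p)  = false∷-≋-[] (⊗-zeroʳ p)

⊗-distribʳ : ∀ p q r → (q ⊕ r) ⊗ p ≋ q ⊗ p ⊕ r ⊗ p
⊗-distribʳ p []      r       = ≋-refl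
⊗-distribʳ p (a ∷ q) []      = ≋-sym (⊕-identityʳ _)
⊗-distribʳ p (a ∷ q) (b ∷ r) = ≋-trans
  (⊕-cong (scale-xor a b p) (∷-cong refl (⊗-distribʳ p q r)))
  (interchange (scale a p) (scale b p) (false ∷ q ⊗ p) (false ∷ r ⊗ p))

⊗-assoc : ∀ p q r → (p ⊗ q) ⊗ r ≋ p ⊗ (q ⊗ r)
⊗-assoc []      q r = ≋-refl
⊗-assoc (a ∷ p) q r = ≋-trans
  (⊗-distribʳ r (scale a q) (false ∷ p ⊗ q))
  (⊕-cong (≡⇒≋ (scale-⊗ a q r)) (∷-cong refl (⊗-assoc p q r)))

⊗-∷ʳ : ∀ p b q → p ⊗ (b ∷ q) ≋ scale b p ⊕ (false ∷ p ⊗ q)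
⊗-∷ʳ []      true  q = mk≋ λ { zero → refl ; (suc k) → refl }
⊗-∷ʳ []      false q = mk≋ λ { zero → refl ; (suc k) → refl }
⊗-∷ʳ (a ∷ p) b     q = ≋-trans
  (⊕-congˡ (scale a (b ∷ q)) (∷-cong refl (⊗-∷ʳ p b q)))
  (swap a b)
  where
  swap : ∀ a b → scale a (b ∷ q) ⊕ (false ∷ (scale b p ⊕ (false ∷ p ⊗ q)))
               ≋ scale b (a ∷ p) ⊕ (false ∷ (scale a q ⊕ (false ∷ p ⊗ q)))
  swap false false = ≋-refl
  swap false true  = ≋-refl
  swap true  false = ≋-refl
  swap true  true  = ∷-cong refl (x∙yz≈y∙xz q p (false ∷ p ⊗ q))

⊗-comm : ∀ p q → p ⊗ q ≋ q ⊗ p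
⊗-comm []      q = ≋-sym (⊗-zeroʳ q)
⊗-comm (a ∷ p) q = ≋-trans
  (⊕-congˡ (scale a q) (∷-cong refl (⊗-comm p q)))
  (≋-sym (⊗-∷ʳ q a p))

⊗-cong : ∀ {p p′ q q′} → p ≋ p′ → q ≋ q′ → p ⊗ q ≋ p′ ⊗ q′
⊗-cong {p} {p′} {q} {q′} e f = ≋-trans (⊗-congˡ p f)
  (≋-trans (⊗-comm p q′) (≋-trans (⊗-congˡ q′ e) (⊗-comm q′ p′)))

⊗-distribˡ : ∀ p q r → p ⊗ (q ⊕ r) ≋ p ⊗ q ⊕ p ⊗ r
⊗-distribˡ p q r = ≋-trans (⊗-comm p (q ⊕ r))
  (≋-trans (⊗-distribʳ p q r) (⊕-cong (⊗-comm q p) (⊗-comm r p)))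

⊗-identityˡ : ∀ p → [ true ] ⊗ p ≋ p
⊗-identityˡ = ⊕-[false]

Poly-commutativeRing : CommutativeRing _ _
Poly-commutativeRing = record
  { Carrier = Poly ; _≈_ = _≋_ ; _+_ = _⊕_ ; _*_ = _⊗_ ; -_ = id ; 0# = [] ; 1# = [ true ]
  ; isCommutativeRing = record
    { isRing = record
      { +-isAbelianGroup = record
        { isGroup = record
          { isMonoid = CommutativeMonoid.isMonoid ⊕-commutativeMonoid
          ; inverse  = ⊕-self , ⊕-self
          ; ⁻¹-cong  = id }
        ; comm = ⊕-comm }
      ; *-cong     = ⊗-cong
      ; *-assoc    = ⊗-assoc
      ; *-identity = ⊗-identityˡ , λ p → ≋-trans (⊗-comm p _) (⊗-identityˡ p)
      ; distrib    = ⊗-distribˡ , ⊗-distribʳ }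
    ; *-comm = ⊗-comm } }

Poly-ring : AlmostCommutativeRing _ _
Poly-ring = fromCommutativeRing Poly-commutativeRing (λ _ → nothing)

open import Algebra.Properties.AbelianGroup (CommutativeRing.+-abelianGroup Poly-commutativeRing)
  using (x∙y⁻¹≈ε⇒x≈y)

all-false-≋-[] : ∀ {p} → All (_≡ false) p → p ≋ []
all-false-≋-[] All.[]         = ≋-refl
all-false-≋-[] (refl All.∷ z) = false∷-≋-[] (all-false-≋-[] z)

≋-by-computation : ∀ p q → {True (all? (_≟ᵇ false) (p ⊕ q))} → p ≋ q
≋-by-computation p q {z} = x∙y⁻¹≈ε⇒x≈y p q (all-false-≋-[] (toWitness z))

open import Relation.Binary.Reasoning.Setoid ≋-setoid

open import Algebra.Properties.CommutativeSemigroup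
  (CommutativeRing.+-commutativeSemigroup xor-∧-commutativeRing)
  using () renaming (interchange to xor-interchange)

Division : Set
Division = Poly × Vec Bool 4

quot : Division → Poly
quot = proj₁

rem : Division → Vec Bool 4
rem = proj₂

infix 4 _≈ᵈ_
_≈ᵈ_ : Division → Division → Set
x ≈ᵈ y = quot x ≋ quot y × rem x ≡ rem y

≈ᵈ-sym : ∀ {x y} → x ≈ᵈ y → y ≈ᵈ x
≈ᵈ-sym (e , e′) = ≋-sym e , sym e′

≈ᵈ-trans : ∀ {x y z} → x ≈ᵈ y → y ≈ᵈ z → x ≈ᵈ z
≈ᵈ-trans (e , e′) (f , f′) = ≋-trans e f , trans e′ f′

infixl 6 _+ᵈ_
_+ᵈ_ : Division → Division → Division
x +ᵈ y = quot x ⊕ quot y , zipWith _xor_ (rem x) (rem y)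

-- From f = q G + s and r⁴ = r³ + G:  a + r f = (s₃ + r q) G + (a + s₀ r + s₁ r² + (s₂ + s₃) r³).
shift : Bool → Division → Division
shift a (q , s₀ ∷ s₁ ∷ s₂ ∷ s₃ ∷ []) = s₃ ∷ q , a ∷ s₀ ∷ s₁ ∷ (s₂ xor s₃) ∷ []

+ᵈ-congˡ : ∀ x {y z} → y ≈ᵈ z → x +ᵈ y ≈ᵈ x +ᵈ z
+ᵈ-congˡ x (e , e′) = ⊕-congˡ (quot x) e , cong (zipWith _xor_ (rem x)) e′

divG-∷ : ∀ a p → divG (a ∷ p) ≡ shift a (divG p)
divG-∷ a p with divG p
... | q , s₀ ∷ s₁ ∷ s₂ ∷ false ∷ [] rewrite xor-identityʳ s₂ = refl
... | q , s₀ ∷ s₁ ∷ s₂ ∷ true  ∷ [] = refl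

shift-cong : ∀ a {x y} → x ≈ᵈ y → shift a x ≈ᵈ shift a y
shift-cong a {q , s₀ ∷ s₁ ∷ s₂ ∷ s₃ ∷ []} (e , refl) = ∷-cong refl e , refl

shift-+ᵈ : ∀ a b x y → shift (a xor b) (x +ᵈ y) ≈ᵈ shift a x +ᵈ shift b y
shift-+ᵈ a b (q , s₀ ∷ s₁ ∷ s₂ ∷ s₃ ∷ []) (q′ , t₀ ∷ t₁ ∷ t₂ ∷ t₃ ∷ []) =
  ≋-refl , cong (λ c → (a xor b) ∷ (s₀ xor t₀) ∷ (s₁ xor t₁) ∷ c ∷ []) (xor-interchange s₂ t₂ s₃ t₃)

divG-zero : ∀ {p} → p ≋ [] → divG p ≈ᵈ divG []
divG-zero {[]}    _ = ≋-refl , refl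
divG-zero {a ∷ p} e with ∷-≋-[] e
... | refl , p≋[] rewrite divG-∷ false p =
  ≈ᵈ-trans (shift-cong false (divG-zero p≋[])) (false∷-≋-[] ≋-refl , refl)

divG-cong : ∀ {p p′} → p ≋ p′ → divG p ≈ᵈ divG p′
divG-cong {[]}    {[]}     _ = ≋-refl , refl
divG-cong {[]}    {b ∷ p′} e = ≈ᵈ-sym (divG-zero (≋-sym e))
divG-cong {a ∷ p} {[]}     e = divG-zero e
divG-cong {a ∷ p} {b ∷ p′} e with ∷-injective e
... | refl , p≋p′ rewrite divG-∷ a p | divG-∷ a p′ = shift-cong a (divG-cong p≋p′)

divG-⊕ : ∀ p q → divG (p ⊕ q) ≈ᵈ divG p +ᵈ divG q
divG-⊕ []      q       = ≋-refl , sym (zipWith-identityˡ (λ _ → refl) (rem (divG q)))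
divG-⊕ (a ∷ p) []      = ≋-sym (⊕-identityʳ _) , sym (zipWith-identityʳ xor-identityʳ (rem (divG (a ∷ p))))
divG-⊕ (a ∷ p) (b ∷ q) rewrite divG-∷ (a xor b) (p ⊕ q) | divG-∷ a p | divG-∷ b q =
  ≈ᵈ-trans (shift-cong (a xor b) (divG-⊕ p q)) (shift-+ᵈ a b (divG p) (divG q))

divG-⊗G : ∀ g → divG (g ⊗ G) ≈ᵈ (g , replicate 4 false)
divG-⊗G []      = ≋-refl , refl
divG-⊗G (a ∷ g) = ≈ᵈ-trans (divG-⊕ (scale a G) (false ∷ g ⊗ G))
  (≈ᵈ-trans (+ᵈ-congˡ (divG (scale a G)) shifted) (leading a))
  where
  shifted : divG (false ∷ g ⊗ G) ≈ᵈ (false ∷ g , replicate 4 false)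
  shifted rewrite divG-∷ false (g ⊗ G) = shift-cong false (divG-⊗G g)

  leading : ∀ a → divG (scale a G) +ᵈ (false ∷ g , replicate 4 false) ≈ᵈ (a ∷ g , replicate 4 false)
  leading false = ≋-refl , refl
  leading true  = ∷-cong refl (⊕-cong (≋-by-computation _ []) ≋-refl) , refl

infixl 7 _·_
_·_ : ∀ {n} → Vec Poly n → Vec Poly n → Poly
[]       · []       = []
(c ∷ cs) · (u ∷ us) = c ⊗ u ⊕ cs · us

·-⊕ : ∀ {n} (c d u : Vec Poly n) → zipWith _⊕_ c d · u ≋ c · u ⊕ d · u
·-⊕ []       []       []       = ≋-refl
·-⊕ (c ∷ cs) (d ∷ ds) (u ∷ us) = ≋-trans (⊕-congˡ ((c ⊕ d) ⊗ u) (·-⊕ cs ds us)) (step c d u (cs · us) (ds · us))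
  where
  step : ∀ c d u x y → (c ⊕ d) ⊗ u ⊕ (x ⊕ y) ≋ (c ⊗ u ⊕ x) ⊕ (d ⊗ u ⊕ y)
  step = solve-∀ Poly-ring

·-⊗ : ∀ {n} p (c u : Vec Poly n) → map (p ⊗_) c · u ≋ p ⊗ (c · u)
·-⊗ p []       []       = ≋-sym (⊗-zeroʳ p)
·-⊗ p (c ∷ cs) (u ∷ us) = ≋-trans (⊕-congˡ ((p ⊗ c) ⊗ u) (·-⊗ p cs us)) (step p c u (cs · us))
  where
  step : ∀ p c u x → (p ⊗ c) ⊗ u ⊕ p ⊗ x ≋ p ⊗ (c ⊗ u ⊕ x)
  step = solve-∀ Poly-ring

Urem : Vec Bool 4 → Poly
Urem s = map [_] s · Ubasis

Urem-xor : ∀ s t → Urem (zipWith _xor_ s t) ≋ Urem s ⊕ Urem t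
Urem-xor (s₀ ∷ s₁ ∷ s₂ ∷ s₃ ∷ []) (t₀ ∷ t₁ ∷ t₂ ∷ t₃ ∷ []) =
  ·-⊕ (map [_] (s₀ ∷ s₁ ∷ s₂ ∷ s₃ ∷ [])) (map [_] (t₀ ∷ t₁ ∷ t₂ ∷ t₃ ∷ [])) Ubasis

-- U(q G + s) = U(s) + F U(q), unrolled k times.
Ufuel : ℕ → Poly → Poly
Ufuel zero    f = []
Ufuel (suc k) f = Urem (rem (divG f)) ⊕ F ⊗ Ufuel k (quot (divG f))

comp-F : Poly → Poly
comp-F g = comp g F

coords-suc : ∀ k f → coords (suc k) f ≡ zipWith _∷_ (rem (divG f)) (coords k (quot (divG f)))
coords-suc k f with divG f
... | q , s₀ ∷ s₁ ∷ s₂ ∷ s₃ ∷ [] with coords k q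
...   | g₀ ∷ g₁ ∷ g₂ ∷ g₃ ∷ [] = refl

comp-F-∷ : ∀ s (g : Vec Poly 4) → map comp-F (zipWith _∷_ s g) ≡ zipWith _⊕_ (map [_] s) (map (F ⊗_) (map comp-F g))
comp-F-∷ (s₀ ∷ s₁ ∷ s₂ ∷ s₃ ∷ []) (g₀ ∷ g₁ ∷ g₂ ∷ g₃ ∷ []) = refl

U-coords : ∀ f → U f ≋ map comp-F (coords (length f) f) · Ubasis
U-coords f with coords (length f) f | Ubasis
... | g₀ ∷ g₁ ∷ g₂ ∷ g₃ ∷ [] | u₀ ∷ u₁ ∷ u₂ ∷ u₃ ∷ [] =
  assoc (comp-F g₀ ⊗ u₀) (comp-F g₁ ⊗ u₁) (comp-F g₂ ⊗ u₂) (comp-F g₃ ⊗ u₃)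
  where
  reassoc : ∀ a b c d → a ⊕ b ⊕ c ⊕ d ≋ a ⊕ (b ⊕ (c ⊕ d))
  reassoc = solve-∀ Poly-ring

  assoc : ∀ a b c d → a ⊕ b ⊕ c ⊕ d ≋ a ⊕ (b ⊕ (c ⊕ (d ⊕ [])))
  assoc a b c d = ≋-trans (reassoc a b c d) (⊕-congˡ a (⊕-congˡ b (⊕-congˡ c (≋-sym (⊕-identityʳ d)))))

coords-Ufuel : ∀ k f → map comp-F (coords k f) · Ubasis ≋ Ufuel k f
coords-Ufuel zero    f = ≋-refl
coords-Ufuel (suc k) f rewrite coords-suc k f = begin
  map comp-F (zipWith _∷_ s g) · Ubasis                            ≡⟨ cong (_· Ubasis) (comp-F-∷ s g) ⟩
  zipWith _⊕_ (map [_] s) (map (F ⊗_) (map comp-F g)) · Ubasis     ≈⟨ ·-⊕ (map [_] s) _ Ubasis ⟩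
  Urem s ⊕ map (F ⊗_) (map comp-F g) · Ubasis                      ≈⟨ ⊕-congˡ (Urem s) (·-⊗ F (map comp-F g) Ubasis) ⟩
  Urem s ⊕ F ⊗ (map comp-F g · Ubasis)                             ≈⟨ ⊕-congˡ (Urem s) (⊗-congˡ F (coords-Ufuel k (quot (divG f)))) ⟩
  Ufuel (suc k) f                                                  ∎
  where
  s = rem (divG f)
  g = coords k (quot (divG f))

Urem-zero : Urem (replicate 4 false) ≋ []
Urem-zero = ≋-by-computation _ []

Ufuel-[] : ∀ k → Ufuel k [] ≋ []
Ufuel-[] zero    = ≋-refl
Ufuel-[] (suc k) = ⊕-cong Urem-zero (≋-trans (⊗-congˡ F (Ufuel-[] k)) (⊗-zeroʳ F))

Ufuel-cong : ∀ k {p p′} → p ≋ p′ → Ufuel k p ≋ Ufuel k p′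
Ufuel-cong zero    _ = ≋-refl
Ufuel-cong (suc k) e with divG-cong e
... | q≋q′ , s≡s′ = ⊕-cong (≡⇒≋ (cong Urem s≡s′)) (⊗-congˡ F (Ufuel-cong k q≋q′))

Ufuel-⊕ : ∀ k p q → Ufuel k (p ⊕ q) ≋ Ufuel k p ⊕ Ufuel k q
Ufuel-⊕ zero    p q = ≋-refl
Ufuel-⊕ (suc k) p q with divG-⊕ p q
... | quot≋ , rem≡ = begin
  Urem (rem (divG (p ⊕ q))) ⊕ F ⊗ Ufuel k (quot (divG (p ⊕ q)))
    ≈⟨ ⊕-cong (≋-trans (≡⇒≋ (cong Urem rem≡)) (Urem-xor (rem dp) (rem dq)))
              (⊗-congˡ F (≋-trans (Ufuel-cong k quot≋) (Ufuel-⊕ k (quot dp) (quot dq)))) ⟩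
  (Urem (rem dp) ⊕ Urem (rem dq)) ⊕ F ⊗ (Ufuel k (quot dp) ⊕ Ufuel k (quot dq))
    ≈⟨ regroup (Urem (rem dp)) (Urem (rem dq)) (Ufuel k (quot dp)) (Ufuel k (quot dq)) ⟩
  Ufuel (suc k) p ⊕ Ufuel (suc k) q ∎
  where
  dp = divG p
  dq = divG q
  regroup : ∀ a b c d → (a ⊕ b) ⊕ F ⊗ (c ⊕ d) ≋ (a ⊕ F ⊗ c) ⊕ (b ⊕ F ⊗ d)
  regroup = solve-∀ Poly-ring

Ufuel-⊗G : ∀ k g → Ufuel (suc k) (g ⊗ G) ≋ F ⊗ Ufuel k g
Ufuel-⊗G k g with divG-⊗G g
... | q≋g , s≡0 = ⊕-cong (≋-trans (≡⇒≋ (cong Urem s≡0)) Urem-zero) (⊗-congˡ F (Ufuel-cong k q≋g))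

VanishesFrom : ℕ → Poly → Set
VanishesFrom n p = ∀ k → n ≤ k → coeff p k ≡ false

vanishesFrom-length : ∀ p → VanishesFrom (length p) p
vanishesFrom-length []      k       _         = refl
vanishesFrom-length (a ∷ p) (suc k) (s≤s n≤k) = vanishesFrom-length p k n≤k

vanishesFrom-mono : ∀ {m n} p → m ≤ n → VanishesFrom m p → VanishesFrom n p
vanishesFrom-mono p m≤n v k n≤k = v k (≤-trans m≤n n≤k)

vanishesFrom-⊕ : ∀ {n} p q → VanishesFrom n p → VanishesFrom n q → VanishesFrom n (p ⊕ q)
vanishesFrom-⊕ p q vp vq k n≤k rewrite coeff-⊕ p q k | vp k n≤k | vq k n≤k = refl

vanishesFrom-zero : ∀ {p} → VanishesFrom 0 p → p ≋ []
vanishesFrom-zero v = mk≋ λ k → v k z≤n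

vanishesFrom-∷ : ∀ {n a p} → VanishesFrom (suc n) (a ∷ p) → VanishesFrom n p
vanishesFrom-∷ v k n≤k = v (suc k) (s≤s n≤k)

vanishesFrom-quot : ∀ n p → VanishesFrom (suc n) p → VanishesFrom n (quot (divG p))
vanishesFrom-quot n       []      _ _ _ = refl
vanishesFrom-quot zero    (a ∷ p) v rewrite divG-∷ a p
  with divG p | divG-zero {p} (vanishesFrom-zero (vanishesFrom-∷ v))
... | q , s₀ ∷ s₁ ∷ s₂ ∷ s₃ ∷ [] | q≋[] , refl = λ { zero _ → refl ; (suc k) _ → coeffs q≋[] k }
vanishesFrom-quot (suc n) (a ∷ p) v rewrite divG-∷ a p
  with divG p | vanishesFrom-quot n p (vanishesFrom-∷ v)
... | q , s₀ ∷ s₁ ∷ s₂ ∷ s₃ ∷ [] | vq = λ { (suc k) (s≤s n≤k) → vq k n≤k }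

Ufuel-stable : ∀ k m f → VanishesFrom k f → Ufuel (k + m) f ≋ Ufuel k f
Ufuel-stable zero    m f v = ≋-trans (Ufuel-cong m (vanishesFrom-zero v)) (Ufuel-[] m)
Ufuel-stable (suc k) m f v = ⊕-congˡ (Urem (rem (divG f)))
  (⊗-congˡ F (Ufuel-stable k m (quot (divG f)) (vanishesFrom-quot k f v)))

U-Ufuel : ∀ k f → VanishesFrom k f → U f ≋ Ufuel k f
U-Ufuel k f v = begin
  U f                                        ≈⟨ U-coords f ⟩
  map comp-F (coords (length f) f) · Ubasis  ≈⟨ coords-Ufuel (length f) f ⟩
  Ufuel (length f) f                         ≈⟨ Ufuel-stable (length f) k f (vanishesFrom-length f) ⟨
  Ufuel (length f + k) f                     ≡⟨ cong (λ n → Ufuel n f) (+-comm (length f) k) ⟩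
  Ufuel (k + length f) f                     ≈⟨ Ufuel-stable k (length f) f v ⟩
  Ufuel k f                                  ∎

vanishesFrom-length-+ : ∀ p q → VanishesFrom (length p + length q) p × VanishesFrom (length p + length q) q
vanishesFrom-length-+ p q =
    vanishesFrom-mono p (m≤m+n (length p) (length q)) (vanishesFrom-length p)
  , vanishesFrom-mono q (m≤n+m (length q) (length p)) (vanishesFrom-length q)

U-cong : ∀ {p q} → p ≋ q → U p ≋ U q
U-cong {p} {q} e with vanishesFrom-length-+ p q
... | vp , vq = ≋-trans (U-Ufuel K p vp) (≋-trans (Ufuel-cong K e) (≋-sym (U-Ufuel K q vq)))
  where K = length p + length q

U-⊕ : ∀ p q → U (p ⊕ q) ≋ U p ⊕ U q
U-⊕ p q with vanishesFrom-length-+ p q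
... | vp , vq = ≋-trans (U-Ufuel K (p ⊕ q) (vanishesFrom-⊕ p q vp vq))
  (≋-trans (Ufuel-⊕ K p q) (≋-sym (⊕-cong (U-Ufuel K p vp) (U-Ufuel K q vq))))
  where K = length p + length q

U-⊗G : ∀ g → U (g ⊗ G) ≋ F ⊗ U g
U-⊗G g with vanishesFrom-length-+ g (g ⊗ G)
... | vg , vgG = ≋-trans (U-Ufuel (suc K) (g ⊗ G) (vanishesFrom-mono (g ⊗ G) (n≤1+n K) vgG))
  (≋-trans (Ufuel-⊗G K g) (⊗-congˡ F (≋-sym (U-Ufuel K g vg))))
  where K = length g + length (g ⊗ G)

U-reduce : ∀ {f} f₀ g → f ≋ f₀ ⊕ g ⊗ G → U f ≋ U f₀ ⊕ F ⊗ U g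
U-reduce f₀ g e = ≋-trans (U-cong e) (≋-trans (U-⊕ f₀ (g ⊗ G)) (⊕-congˡ (U f₀) (U-⊗G g)))

comp-⊕ : ∀ p q x → comp (p ⊕ q) x ≋ comp p x ⊕ comp q x
comp-⊕ []      q       x = ≋-refl
comp-⊕ (a ∷ p) []      x = ≋-sym (⊕-identityʳ _)
comp-⊕ (a ∷ p) (b ∷ q) x = ≋-trans
  (⊕-congˡ [ a xor b ] (≋-trans (⊗-congˡ x (comp-⊕ p q x)) (⊗-distribˡ x (comp p x) (comp q x))))
  (interchange [ a ] [ b ] (x ⊗ comp p x) (x ⊗ comp q x))

comp-scale : ∀ a q x → comp (scale a q) x ≡ scale a (comp q x)
comp-scale true  q x = refl
comp-scale false q x = refl

const-⊗ : ∀ a p → [ a ] ⊗ p ≋ scale a p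
const-⊗ a p = ⊕-[false] (scale a p)

comp-⊗ : ∀ p q x → comp (p ⊗ q) x ≋ comp p x ⊗ comp q x
comp-⊗ []      q x = ≋-refl
comp-⊗ (a ∷ p) q x = begin
  comp (scale a q ⊕ (false ∷ p ⊗ q)) x            ≈⟨ comp-⊕ (scale a q) (false ∷ p ⊗ q) x ⟩
  comp (scale a q) x ⊕ comp (false ∷ p ⊗ q) x     ≈⟨ ⊕-cong (≡⇒≋ (comp-scale a q x)) (⊕-comm [ false ] _) ⟩
  scale a (comp q x) ⊕ (x ⊗ comp (p ⊗ q) x ⊕ [ false ])
    ≈⟨ ⊕-cong (≋-sym (const-⊗ a (comp q x))) (≋-trans (⊕-[false] _) (⊗-congˡ x (comp-⊗ p q x))) ⟩
  [ a ] ⊗ comp q x ⊕ x ⊗ (comp p x ⊗ comp q x)    ≈⟨ distrib [ a ] x (comp p x) (comp q x) ⟩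
  ([ a ] ⊕ x ⊗ comp p x) ⊗ comp q x               ∎
  where
  distrib : ∀ a x c d → a ⊗ d ⊕ x ⊗ (c ⊗ d) ≋ (a ⊕ x ⊗ c) ⊗ d
  distrib = solve-∀ Poly-ring

X^-+ : ∀ m n → X^ (m + n) ≋ X^ m ⊗ X^ n
X^-+ zero    n = ≋-sym (⊗-identityˡ (X^ n))
X^-+ (suc m) n = ∷-cong refl (X^-+ m n)

U-X^-recurrence : ∀ n → U (X^ (n + 4)) ≋ U (X^ (n + 3)) ⊕ F ⊗ U (X^ n)
U-X^-recurrence n = U-reduce (X^ (n + 3)) (X^ n) (begin
  X^ (n + 4)                 ≈⟨ X^-+ n 4 ⟩
  X^ n ⊗ X^ 4                ≈⟨ ⊗-congˡ (X^ n) (≋-by-computation (X^ 4) (X^ 3 ⊕ G)) ⟩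
  X^ n ⊗ (X^ 3 ⊕ G)          ≈⟨ ⊗-distribˡ (X^ n) (X^ 3) G ⟩
  X^ n ⊗ X^ 3 ⊕ X^ n ⊗ G     ≈⟨ ⊕-congʳ (X^ n ⊗ G) (X^-+ n 3) ⟨
  X^ (n + 3) ⊕ X^ n ⊗ G      ∎)

r²+r : Poly
r²+r = false ∷ true ∷ true ∷ []

r²+r-even-reduction : ∀ n → r²+r ⊗ X^ (2 * (4 + n)) ≋ r²+r ⊗ X^ (2 * (3 + n)) ⊕ ((r²+r ⊗ X^ (2 * n)) ⊗ G) ⊗ G
r²+r-even-reduction n = begin
  r²+r ⊗ X^ (2 * (4 + n))                        ≡⟨ cong (λ e → r²+r ⊗ X^ e) (*-distribˡ-+ 2 4 n) ⟩
  r²+r ⊗ X^ (8 + m)                              ≈⟨ ⊗-congˡ r²+r (X^-+ 8 m) ⟩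
  r²+r ⊗ (X^ 8 ⊗ X^ m)                           ≈⟨ ⊗-congˡ r²+r (⊗-cong (≋-by-computation (X^ 8) (X^ 6 ⊕ G ⊗ G)) ≋-refl) ⟩
  r²+r ⊗ ((X^ 6 ⊕ G ⊗ G) ⊗ X^ m)                 ≈⟨ expand r²+r (X^ 6) G (X^ m) ⟩
  r²+r ⊗ (X^ 6 ⊗ X^ m) ⊕ ((r²+r ⊗ X^ m) ⊗ G) ⊗ G  ≈⟨ ⊕-congʳ (((r²+r ⊗ X^ m) ⊗ G) ⊗ G) (⊗-congˡ r²+r (X^-+ 6 m)) ⟨
  r²+r ⊗ X^ (6 + m) ⊕ ((r²+r ⊗ X^ m) ⊗ G) ⊗ G    ≡⟨ cong (λ e → r²+r ⊗ X^ e ⊕ ((r²+r ⊗ X^ m) ⊗ G) ⊗ G) (*-distribˡ-+ 2 3 n) ⟨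
  r²+r ⊗ X^ (2 * (3 + n)) ⊕ ((r²+r ⊗ X^ m) ⊗ G) ⊗ G ∎
  where
  m = 2 * n
  expand : ∀ h a g y → h ⊗ ((a ⊕ g ⊗ g) ⊗ y) ≋ h ⊗ (a ⊗ y) ⊕ ((h ⊗ y) ⊗ g) ⊗ g
  expand = solve-∀ Poly-ring

A : ℕ → Poly
A 0 = true ∷ []
A 1 = true ∷ true ∷ []
A 2 = false ∷ true ∷ true ∷ []
A 3 = false ∷ false ∷ true ∷ true ∷ []
A (suc (suc (suc (suc n)))) = A (suc (suc (suc n))) ⊕ F ⊗ A n

UEvenFormula : ℕ → Set
UEvenFormula n = U (r²+r ⊗ X^ (2 * n)) ≋ r²+r ⊗ comp (A n) (X^ 2)

UEvenFormula-step : ∀ n → UEvenFormula n → UEvenFormula (3 + n) → UEvenFormula (4 + n)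
UEvenFormula-step n hₙ hₙ₊₃ = begin
  U (r²+r ⊗ X^ (2 * (4 + n)))
    ≈⟨ U-reduce (r²+r ⊗ X^ (2 * (3 + n))) ((r²+r ⊗ X^ (2 * n)) ⊗ G) (r²+r-even-reduction n) ⟩
  U (r²+r ⊗ X^ (2 * (3 + n))) ⊕ F ⊗ U ((r²+r ⊗ X^ (2 * n)) ⊗ G)
    ≈⟨ ⊕-cong hₙ₊₃ (⊗-congˡ F (≋-trans (U-⊗G (r²+r ⊗ X^ (2 * n))) (⊗-congˡ F hₙ))) ⟩
  r²+r ⊗ a ⊕ F ⊗ (F ⊗ (r²+r ⊗ b))
    ≈⟨ regroup r²+r a b ⟩
  r²+r ⊗ (a ⊕ (F ⊗ F) ⊗ b)
    ≈⟨ ⊗-congˡ r²+r (⊕-congˡ a (⊗-cong (≋-by-computation (comp F (X^ 2)) (F ⊗ F)) ≋-refl)) ⟨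
  r²+r ⊗ (a ⊕ comp F (X^ 2) ⊗ b)
    ≈⟨ ⊗-congˡ r²+r (≋-trans (comp-⊕ (A (3 + n)) (F ⊗ A n) (X^ 2)) (⊕-congˡ a (comp-⊗ F (A n) (X^ 2)))) ⟨
  r²+r ⊗ comp (A (4 + n)) (X^ 2) ∎
  where
  a = comp (A (3 + n)) (X^ 2)
  b = comp (A n) (X^ 2)
  regroup : ∀ h a b → h ⊗ a ⊕ F ⊗ (F ⊗ (h ⊗ b)) ≋ h ⊗ (a ⊕ (F ⊗ F) ⊗ b)
  regroup = solve-∀ Poly-ring

UEvenFormula-window : ∀ n → UEvenFormula n × UEvenFormula (1 + n) × UEvenFormula (2 + n) × UEvenFormula (3 + n)
UEvenFormula-window zero = ≋-by-computation _ _ , ≋-by-computation _ _ , ≋-by-computation _ _ , ≋-by-computation _ _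
UEvenFormula-window (suc n) with UEvenFormula-window n
... | h₀ , h₁ , h₂ , h₃ = h₁ , h₂ , h₃ , UEvenFormula-step n h₀ h₃

lemma1p5 : ((n : ℕ) → U (X^ (n + 4)) ≈ U (X^ (n + 3)) ⊕ (false ∷ true ∷ true ∷ true ∷ true ∷ []) ⊗ U (X^ n))
         × ((n : ℕ) → Σ Poly (λ A → U ((false ∷ true ∷ true ∷ []) ⊗ X^ (2 * n)) ≈ (false ∷ true ∷ true ∷ []) ⊗ comp A (X^ 2)))
lemma1p5 = (λ n → coeffs (U-X^-recurrence n)) , (λ n → A n , coeffs (proj₁ (UEvenFormula-window n)))
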